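{- Let $n\geq 3$ and $2\leq r\leq \binom{n}{2}$ be integers, and let $t$ be the unique positive integer with $\binom{t}{2}+2\leq r\leq \binom{t+1}{2}+1$. Let $S\subseteq V(K_n)$ with $|S|=t$ and let $u\in V(K_n)\setminus S$. Let $\phi^*_r$ be the $r$-edge-coloring of $K_n$ obtained as follows: (1) the $\binom{t}{2}$ edges of $K_n[S]$ receive pairwise distinct colors; (2) each of the colors not yet used is assigned to a distinct, not yet colored edge $uv$ with $v\in S$ (as long as such edges remain); (3) all remaining uncolored edges receive one common color, namely the color not yet used if one remains, and otherwise a single (fixed) color among those already used. Then $t_r(K_n,\phi^*_r)=\left\lceil\frac{n-t}{2}\right\rceil$.
   Context: An $r$-edge-coloring of a graph $G$ is an assignment of one of $r$ colors to each edge such that each of the $r$ colors appears on at least one edge. A heterochromatic tree is an edge-colored tree in which any two edges have different colors; a single vertex counts as a heterochromatic tree. For an $r$-edge-coloring $\phi$ of $G$, $t_r(G,\phi)$ is the minimum number of vertex-disjoint heterochromatic trees needed to cover all vertices of $G$. -}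

module Defs where

open import Data.Nat using (ℕ; suc; _+_; _∸_; _≤_; _⊓_)
open import Data.Nat.Combinatorics using (_C_)
open import Data.Fin using (Fin; _≟_)
open import Data.Fin.Subset using (Subset; _∈_; _∉_; _⊆_; ∣_∣)
open import Data.List using (List; length; map; filter; allFin)
open import Data.List.Membership.Propositional using () renaming (_∈_ to _∈ₗ_)
open import Data.List.Relation.Unary.Unique.Propositional using (Unique)
open import Data.Product using (Σ; ∃; ∃₂; _×_; _,_)
open import Data.Sum using (_⊎_)
open import Relation.Binary.PropositionalEquality using (_≡_; _≢_)
open import Relation.Nullary using (¬_)

-- The complete graph K_n has vertex set Fin n; an edge is an unordered pair
-- {x , y} with x ≢ y.

SymColoring : (n r : ℕ) → (Fin n → Fin n → Fin r) → Set
SymColoring n r φ = ∀ (x y : Fin n) → x ≢ y → φ x y ≡ φ y x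

IsREdgeColoring : (n r : ℕ) → (Fin n → Fin n → Fin r) → Set
IsREdgeColoring n r φ =
  SymColoring n r φ × (∀ (c : Fin r) → ∃₂ λ (x y : Fin n) → x ≢ y × φ x y ≡ c)

SameEdge : {n : ℕ} → Fin n → Fin n → Fin n → Fin n → Set
SameEdge x y x′ y′ = (x ≡ x′ × y ≡ y′) ⊎ (x ≡ y′ × y ≡ x′)

data Reach {n : ℕ} (E : List (Fin n × Fin n)) : Fin n → Fin n → Set where
  here : ∀ {x} → Reach E x x
  fwd  : ∀ {x y z} → (x , y) ∈ₗ E → Reach E y z → Reach E x z
  bwd  : ∀ {x y z} → (y , x) ∈ₗ E → Reach E y z → Reach E x z

partSize : {n k : ℕ} → (Fin n → Fin k) → Fin k → ℕ
partSize {n} p i = length (filter (λ x → p x ≟ i) (allFin n))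

-- E is the edge set of a heterochromatic tree (w.r.t. φ) spanning exactly
-- the vertices {x | p x ≡ i} in K_n:
--  * every edge joins two distinct vertices of the part,
--  * the edges have pairwise distinct colours (hence are pairwise distinct),
--  * the part is connected by E,
--  * |E| = |part| - 1  (connected with |V|-1 edges, i.e. a tree).
IsHeteroSpanningTree : {n k r : ℕ} → (Fin n → Fin n → Fin r) →
                       (Fin n → Fin k) → Fin k → List (Fin n × Fin n) → Set
IsHeteroSpanningTree {n} φ p i E =
  (∀ {x y} → (x , y) ∈ₗ E → x ≢ y × p x ≡ i × p y ≡ i)
  × Unique (map (λ e → φ (Data.Product.proj₁ e) (Data.Product.proj₂ e)) E)
  × (∀ (x y : Fin n) → p x ≡ i → p y ≡ i → Reach E x y)
  × (length E + 1 ≡ partSize p i)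

HeteroTreeCover : (n r : ℕ) → (Fin n → Fin n → Fin r) → ℕ → Set
HeteroTreeCover n r φ k =
  Σ (Fin n → Fin k) λ p →
  Σ (Fin k → List (Fin n × Fin n)) λ T →
    (∀ (i : Fin k) → ∃ λ (x : Fin n) → p x ≡ i)
    × (∀ (i : Fin k) → IsHeteroSpanningTree φ p i (T i))

TreeCoverNumber≡ : (n r : ℕ) → (Fin n → Fin n → Fin r) → ℕ → Set
TreeCoverNumber≡ n r φ m =
  HeteroTreeCover n r φ m × (∀ (k : ℕ) → HeteroTreeCover n r φ k → m ≤ k)

-- edges coloured in steps (1) and (2): edges inside S, and edges u v with
-- v ∈ T, where T ⊆ S is the set of neighbours v whose edge uv got a new
-- colour in step (2).
InA : {n : ℕ} → Subset n → Fin n → Subset n → Fin n → Fin n → Set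
InA S u T x y = (x ∈ S × y ∈ S) ⊎ (x ≡ u × y ∈ T) ⊎ (y ≡ u × x ∈ T)

-- Step (2) colours min(r - C(t,2), t) edges uv (as long as colours and edges
-- remain); steps (1),(2) use pairwise distinct colours; step (3) gives all
-- other edges one common colour c.  Together with φ being an r-edge-colouring
-- (surjective), c is forced to be the unused colour if one remains, and is an
-- arbitrary (already used) colour otherwise.
IsPhiStar : (n r t : ℕ) → Subset n → Fin n → (Fin n → Fin n → Fin r) → Set
IsPhiStar n r t S u φ =
  Σ (Subset n) λ T →
  Σ (Fin r) λ c →
    T ⊆ S
    × ∣ T ∣ ≡ (r ∸ t C 2) ⊓ t
    × (∀ (x y x′ y′ : Fin n) → x ≢ y → x′ ≢ y′ →
         InA S u T x y → InA S u T x′ y′ → φ x y ≡ φ x′ y′ → SameEdge x y x′ y′)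
    × (∀ (x y : Fin n) → x ≢ y → ¬ InA S u T x y → φ x y ≡ c)

module Submission where

-- Write A for the edges coloured in steps (1)-(2) (inside S, and u v with
-- v ∈ T ⊆ S); they have pairwise distinct colours, and every other edge has
-- the common colour c.  Call the vertices outside the core S ∪ {u} outer;
-- every edge at an outer vertex has colour c.
--
-- Two outer vertices of one heterochromatic tree have a
-- c-coloured tree edge each, necessarily the same one, so the tree is that
-- edge.  Hence a tree contains at most two of the n - t vertices outside S,
-- and summing over the k trees gives n - t ≤ 2k.
--
-- Pair up the n - t - 1 outer vertices into single-edge
-- trees; the last tree spans the core (plus the leftover outer vertex w
-- when n - t is even, attached by the c-coloured edge w v₁).  The core tree
-- is given by a parent map of depth ≤ 2 towards a root v₁ ∈ T along A-edges
-- avoiding colour c: the star at v₁, where the one star edge v₁ b of colour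
-- c (if any) is replaced by an edge from a second vertex of T, or from u.
-- When t = 1 there is no second vertex, but then φ would be monochromatic.

open import Defs
open import Data.Nat using (ℕ; zero; suc; _+_; _*_; _∸_; _≤_; z≤n; s≤s; ⌈_/2⌉; _⊓_)
open import Data.Nat.Properties hiding (_≟_)
open import Data.Nat.Combinatorics using (_C_)
open import Data.Fin using (Fin; zero; suc; _≟_)
open import Data.Fin.Properties using (any?)
open import Data.Fin.Subset using (Subset; _∈_; _∉_; _⊆_; ∣_∣; inside; outside)
open import Data.Fin.Subset.Properties using (_∈?_)
open import Data.Vec using ([]; _∷_; here; there)
open import Data.List using (List; []; _∷_; length; map; filter; allFin; tabulate; lookup)
open import Data.List.Membership.Propositional using () renaming (_∈_ to _∈ₗ_; _∉_ to _∉ₗ_)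
open import Data.List.Relation.Unary.Unique.Propositional using (Unique)
open import Data.List.Relation.Unary.AllPairs using ([]; _∷_)
open import Data.List.Relation.Unary.All using (All; []; _∷_)
open import Data.List.Relation.Unary.Any using (here; there)
open import Data.Product using (Σ; ∃; _×_; _,_; proj₁; proj₂)
open import Data.Sum using (_⊎_; inj₁; inj₂; swap) renaming (map to ⊎-map)
open import Data.Maybe using (Maybe; just; nothing)
open import Function using (_∘_)
open import Data.Empty using (⊥; ⊥-elim)
open import Relation.Nullary using (¬_; Dec; yes; no)
open import Relation.Nullary.Decidable using (_×-dec_; _⊎-dec_; ¬?)
open import Relation.Unary using (Decidable)
open import Relation.Binary.PropositionalEquality using (_≡_; _≢_; refl; sym; trans; cong; cong₂; subst; ≢-sym; module ≡-Reasoning)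

module Counting where

  indicator : ∀ {a} {A : Set a} → Dec A → ℕ
  indicator (yes _) = 1
  indicator (no _)  = 0

  count : ∀ {n} {P : Fin n → Set} → Decidable P → ℕ
  count {zero}  P? = 0
  count {suc n} P? = indicator (P? zero) + count (λ x → P? (suc x))

  count-cong : ∀ {n} {P Q : Fin n → Set} (P? : Decidable P) (Q? : Decidable Q) →
    (∀ x → P x → Q x) → (∀ x → Q x → P x) → count P? ≡ count Q?
  count-cong {zero}  P? Q? f g = refl
  count-cong {suc n} P? Q? f g with P? zero | Q? zero
  ... | yes p | yes q = cong suc (count-cong _ _ (λ x → f (suc x)) (λ x → g (suc x)))
  ... | yes p | no ¬q = ⊥-elim (¬q (f zero p))
  ... | no ¬p | yes q = ⊥-elim (¬p (g zero q))
  ... | no ¬p | no ¬q = count-cong _ _ (λ x → f (suc x)) (λ x → g (suc x))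

  count-complement : ∀ {n} {P : Fin n → Set} (P? : Decidable P) →
    count P? + count (λ x → ¬? (P? x)) ≡ n
  count-complement {zero}  P? = refl
  count-complement {suc n} P? with P? zero
  ... | yes _ = cong suc (count-complement (λ x → P? (suc x)))
  ... | no _  = trans (+-suc _ _) (cong suc (count-complement (λ x → P? (suc x))))

  count-split : ∀ {n} {P Q : Fin n → Set} (P? : Decidable P) (Q? : Decidable Q) →
    count P? ≡ count (λ x → P? x ×-dec Q? x) + count (λ x → P? x ×-dec ¬? (Q? x))
  count-split {zero}  P? Q? = refl
  count-split {suc n} P? Q? with P? zero | Q? zero
  ... | yes _ | yes _ = cong suc (count-split (λ x → P? (suc x)) (λ x → Q? (suc x)))
  ... | yes _ | no _  = trans (cong suc (count-split (λ x → P? (suc x)) (λ x → Q? (suc x))))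
                              (sym (+-suc _ _))
  ... | no _  | yes _ = count-split (λ x → P? (suc x)) (λ x → Q? (suc x))
  ... | no _  | no _  = count-split (λ x → P? (suc x)) (λ x → Q? (suc x))

  count-empty : ∀ {n} {P : Fin n → Set} (P? : Decidable P) → (∀ x → ¬ P x) → count P? ≡ 0
  count-empty {zero}  P? none = refl
  count-empty {suc n} P? none with P? zero
  ... | yes p = ⊥-elim (none zero p)
  ... | no _  = count-empty (λ x → P? (suc x)) (λ x → none (suc x))

  count-singleton : ∀ {n} (v : Fin n) → count (λ x → x ≟ v) ≡ 1
  count-singleton {suc n} zero = cong suc (count-empty {n} (λ x → suc x ≟ zero) (λ x ()))
  count-singleton {suc n} (suc v) =
    trans (count-cong (λ x → suc x ≟ suc v) (λ x → x ≟ v) (λ { x refl → refl }) (λ { x refl → refl }))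
          (count-singleton v)

  count-remove : ∀ {n} {P : Fin n → Set} (P? : Decidable P) (v : Fin n) → P v →
    count P? ≡ suc (count (λ x → P? x ×-dec ¬? (x ≟ v)))
  count-remove P? v pv = trans (count-split P? (λ x → x ≟ v))
    (cong (_+ count (λ x → P? x ×-dec ¬? (x ≟ v)))
      (trans (count-cong (λ x → P? x ×-dec (x ≟ v)) (λ x → x ≟ v) (λ x → proj₂) (λ { x refl → pv , refl }))
             (count-singleton v)))

  count-insert : ∀ {n} {P : Fin n → Set} (P? : Decidable P) (v : Fin n) → ¬ P v →
    count (λ x → P? x ⊎-dec (x ≟ v)) ≡ suc (count P?)
  count-insert P? v ¬pv = trans (count-remove (λ x → P? x ⊎-dec (x ≟ v)) v (inj₂ refl))
    (cong suc (count-cong _ P? (λ { x (inj₁ p , _) → p ; x (inj₂ e , ne) → ⊥-elim (ne e) })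
                               (λ x p → inj₁ p , λ { refl → ¬pv p })))

  count-witness : ∀ {n} {P : Fin n → Set} (P? : Decidable P) → 1 ≤ count P? → ∃ P
  count-witness {suc n} P? pos with P? zero
  ... | yes p = zero , p
  ... | no _ with count-witness (λ x → P? (suc x)) pos
  ...   | x , px = suc x , px

  count-another : ∀ {n} {P : Fin n → Set} (P? : Decidable P) {v : Fin n} → P v →
    2 ≤ count P? → ∃ λ x → P x × x ≢ v
  count-another P? {v} pv two =
    count-witness (λ x → P? x ×-dec ¬? (x ≟ v)) (≤-pred (≤-trans two (≤-reflexive (count-remove P? v pv))))

  count-positive : ∀ {n} {P : Fin n → Set} (P? : Decidable P) {v : Fin n} → P v → 1 ≤ count P?
  count-positive P? {v} pv = ≤-trans (s≤s z≤n) (≤-reflexive (sym (count-remove P? v pv)))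

  count-≤1-unique : ∀ {n} {P : Fin n → Set} (P? : Decidable P) → count P? ≤ 1 →
    ∀ {x y} → P x → P y → x ≡ y
  count-≤1-unique P? one {x} {y} px py with x ≟ y
  ... | yes x≡y = x≡y
  ... | no x≢y = ⊥-elim (1+n≰n (≤-trans (s≤s (count-positive (λ z → P? z ×-dec ¬? (z ≟ y)) (px , x≢y)))
                                         (≤-trans (≤-reflexive (sym (count-remove P? y py))) one)))

  count-≤2 : ∀ {n} {P : Fin n → Set} (P? : Decidable P) →
    (∀ {x y z} → P x → P y → P z → x ≢ y → x ≢ z → y ≢ z → ⊥) → count P? ≤ 2
  count-≤2 P? noTriple with count P? ≤? 2
  ... | yes le = le
  ... | no gt
    with count-witness P? (≤-trans (s≤s z≤n) (≰⇒> gt))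
  ... | x , px
    with count-another P? px (≤-trans (s≤s (s≤s z≤n)) (≰⇒> gt))
  ... | y , py , y≢x
    with count-another (λ w → P? w ×-dec ¬? (w ≟ x)) (py , y≢x)
           (≤-pred (≤-trans (≰⇒> gt) (≤-reflexive (count-remove P? x px))))
  ... | z , (pz , z≢x) , z≢y = ⊥-elim (noTriple px py pz (≢-sym y≢x) (≢-sym z≢x) (≢-sym z≢y))

  length-filter-tabulate : ∀ {n} {a} {A : Set a} {P : A → Set} (P? : Decidable P) (f : Fin n → A) →
    length (filter P? (tabulate f)) ≡ count (λ x → P? (f x))
  length-filter-tabulate {zero}  P? f = refl
  length-filter-tabulate {suc n} P? f with P? (f zero)
  ... | yes _ = cong suc (length-filter-tabulate P? (λ x → f (suc x)))
  ... | no _  = length-filter-tabulate P? (λ x → f (suc x))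

  length-filter-allFin : ∀ {n} {P : Fin n → Set} (P? : Decidable P) →
    length (filter P? (allFin n)) ≡ count P?
  length-filter-allFin P? = length-filter-tabulate P? (λ x → x)

  count-∈ : ∀ {n} (S : Subset n) → count (λ x → x ∈? S) ≡ ∣ S ∣
  count-∈ {zero}  []           = refl
  count-∈ {suc n} (inside ∷ S) =
    cong suc (trans (count-cong (λ x → suc x ∈? (inside ∷ S)) (λ x → x ∈? S) (λ { x (there p) → p }) (λ x → there))
                    (count-∈ S))
  count-∈ {suc n} (outside ∷ S) =
    trans (count-cong (λ x → suc x ∈? (outside ∷ S)) (λ x → x ∈? S) (λ { x (there p) → p }) (λ x → there))
          (count-∈ S)

  subset-witness : ∀ {n} (S : Subset n) → 1 ≤ ∣ S ∣ → ∃ (_∈ S)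
  subset-witness S one = count-witness (λ x → x ∈? S) (subst (1 ≤_) (sym (count-∈ S)) one)

  subset-another : ∀ {n} (S : Subset n) {v} → v ∈ S → 2 ≤ ∣ S ∣ → ∃ λ x → x ∈ S × x ≢ v
  subset-another S v∈S two = count-another (λ x → x ∈? S) v∈S (subst (2 ≤_) (sym (count-∈ S)) two)

  subset-≤1-unique : ∀ {n} (S : Subset n) → ∣ S ∣ ≤ 1 → ∀ {x y} → x ∈ S → y ∈ S → x ≡ y
  subset-≤1-unique S one = count-≤1-unique (λ x → x ∈? S) (subst (_≤ 1) (sym (count-∈ S)) one)

  count-∉ : ∀ {n} (S : Subset n) → count (λ x → ¬? (x ∈? S)) ≡ n ∸ ∣ S ∣
  count-∉ {n} S = begin
    count ∉S                         ≡⟨ sym (m+n∸m≡n (count ∈S) _) ⟩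
    count ∈S + count ∉S ∸ count ∈S   ≡⟨ cong₂ _∸_ (count-complement ∈S) (count-∈ S) ⟩
    n ∸ ∣ S ∣                        ∎
    where
    open ≡-Reasoning
    ∈S : Decidable (_∈ S)
    ∈S x = x ∈? S
    ∉S : Decidable (_∉ S)
    ∉S x = ¬? (x ∈? S)

module Sums where
  open Counting
  open import Algebra.Properties.CommutativeSemigroup +-commutativeSemigroup using (interchange)

  sumFin : ∀ k → (Fin k → ℕ) → ℕ
  sumFin zero    f = 0
  sumFin (suc k) f = f zero + sumFin k (λ i → f (suc i))

  sum-cong : ∀ k {f g : Fin k → ℕ} → (∀ i → f i ≡ g i) → sumFin k f ≡ sumFin k g
  sum-cong zero    eq = refl
  sum-cong (suc k) eq = cong₂ _+_ (eq zero) (sum-cong k (λ i → eq (suc i)))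

  sum-+ : ∀ k (f g : Fin k → ℕ) → sumFin k (λ i → f i + g i) ≡ sumFin k f + sumFin k g
  sum-+ zero    f g = refl
  sum-+ (suc k) f g = trans (cong (f zero + g zero +_) (sum-+ k _ _)) (interchange (f zero) (g zero) _ _)

  sum-zero : ∀ k → sumFin k (λ _ → 0) ≡ 0
  sum-zero zero    = refl
  sum-zero (suc k) = sum-zero k

  sum-≤ : ∀ k (f : Fin k → ℕ) b → (∀ i → f i ≤ b) → sumFin k f ≤ k * b
  sum-≤ zero    f b le = z≤n
  sum-≤ (suc k) f b le = +-mono-≤ (le zero) (sum-≤ k _ b (λ i → le (suc i)))

  sum-delta : ∀ k (j : Fin k) → sumFin k (λ i → indicator (j ≟ i)) ≡ 1
  sum-delta (suc k) zero    = cong suc (trans (sum-cong k (λ i → refl)) (sum-zero k))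
  sum-delta (suc k) (suc j) = trans (sum-cong k shift) (sum-delta k j)
    where
    shift : ∀ i → indicator (suc j ≟ suc i) ≡ indicator (j ≟ i)
    shift i with j ≟ i
    ... | yes _ = refl
    ... | no  _ = refl

  count-partition : ∀ {n k} {P : Fin n → Set} (P? : Decidable P) (p : Fin n → Fin k) →
    count P? ≡ sumFin k (λ i → count (λ x → P? x ×-dec (p x ≟ i)))
  count-partition {zero}  {k} P? p = sym (sum-zero k)
  count-partition {suc n} {k} P? p =
    sym (trans (sum-+ k _ _) (cong₂ _+_ (head (P? zero)) (sym (count-partition (λ x → P? (suc x)) (λ x → p (suc x))))))
    where
    head : ∀ {a} {A : Set a} (d : Dec A) → sumFin k (λ i → indicator (d ×-dec (p zero ≟ i))) ≡ indicator d
    head (yes a) = trans (sum-cong k drop-yes) (sum-delta k (p zero))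
      where
      drop-yes : ∀ i → indicator (yes a ×-dec (p zero ≟ i)) ≡ indicator (p zero ≟ i)
      drop-yes i with p zero ≟ i
      ... | yes _ = refl
      ... | no  _ = refl
    head (no _) = sum-zero k

edgeColour : ∀ {n r} → (Fin n → Fin n → Fin r) → Fin n × Fin n → Fin r
edgeColour φ e = φ (proj₁ e) (proj₂ e)

module Walks where
  open import Data.List.Relation.Unary.All.Properties using (map⁻; map⁺)
  import Data.List.Relation.Unary.All as All

  module _ {n : ℕ} {E : List (Fin n × Fin n)} where

    reach-trans : ∀ {x y z} → Reach E x y → Reach E y z → Reach E x z
    reach-trans here      q = q
    reach-trans (fwd e p) q = fwd e (reach-trans p q)
    reach-trans (bwd e p) q = bwd e (reach-trans p q)

    reach-sym : ∀ {x y} → Reach E x y → Reach E y x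
    reach-sym here      = here
    reach-sym (fwd e p) = reach-trans (reach-sym p) (bwd e here)
    reach-sym (bwd e p) = reach-trans (reach-sym p) (fwd e here)

    reach-closed : (V : Fin n → Set) → (∀ {a b} → (a , b) ∈ₗ E → V a ⊎ V b → V a × V b) →
      ∀ {x z} → Reach E x z → V x → V z
    reach-closed V closed here      vx = vx
    reach-closed V closed (fwd e p) vx = reach-closed V closed p (proj₂ (closed e (inj₁ vx)))
    reach-closed V closed (bwd e p) vx = reach-closed V closed p (proj₁ (closed e (inj₂ vx)))

    reach-weaken : ∀ {E′ x z} → (∀ {e} → e ∈ₗ E → e ∈ₗ E′) → Reach E x z → Reach E′ x z
    reach-weaken ⊆E′ here      = here
    reach-weaken ⊆E′ (fwd e p) = fwd (⊆E′ e) (reach-weaken ⊆E′ p)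
    reach-weaken ⊆E′ (bwd e p) = bwd (⊆E′ e) (reach-weaken ⊆E′ p)

    first-edge : ∀ {x z} → Reach E x z → x ≢ z → ∃ λ y → (x , y) ∈ₗ E ⊎ (y , x) ∈ₗ E
    first-edge here              x≢z = ⊥-elim (x≢z refl)
    first-edge (fwd {y = y} e _) _   = y , inj₁ e
    first-edge (bwd {y = y} e _) _   = y , inj₂ e

  module _ {A B : Set} (f : A → B) where

    unique-map⇒injective : ∀ {xs} → Unique (map f xs) →
      ∀ {a b} → a ∈ₗ xs → b ∈ₗ xs → f a ≡ f b → a ≡ b
    unique-map⇒injective (_ ∷ _) (here refl) (here refl) _ = refl
    unique-map⇒injective (fx∉ ∷ _) (here refl) (there b∈) eq = ⊥-elim (All.lookup (map⁻ fx∉) b∈ eq)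
    unique-map⇒injective (fx∉ ∷ _) (there a∈) (here refl) eq = ⊥-elim (All.lookup (map⁻ fx∉) a∈ (sym eq))
    unique-map⇒injective (_ ∷ u) (there a∈) (there b∈) eq = unique-map⇒injective u a∈ b∈ eq

    injective⇒unique-map : ∀ xs → (∀ {a b} → a ∈ₗ xs → b ∈ₗ xs → f a ≡ f b → a ≡ b) →
      Unique xs → Unique (map f xs)
    injective⇒unique-map [] _ [] = []
    injective⇒unique-map (x ∷ xs) inj (x∉ ∷ u) =
      map⁺ (All.tabulate (λ y∈ eq → All.lookup x∉ y∈ (inj (here refl) (there y∈) eq)))
      ∷ injective⇒unique-map xs (λ a∈ b∈ → inj (there a∈) (there b∈)) u

module Tree {n k r : ℕ} {φ : Fin n → Fin n → Fin r} {p : Fin n → Fin k} {i : Fin k}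
            {E : List (Fin n × Fin n)} (tree : IsHeteroSpanningTree φ p i E) where

  edges-inside : ∀ {x y} → (x , y) ∈ₗ E → x ≢ y × p x ≡ i × p y ≡ i
  edges-inside = proj₁ tree

  rainbow : Unique (map (edgeColour φ) E)
  rainbow = proj₁ (proj₂ tree)

  connected : ∀ x y → p x ≡ i → p y ≡ i → Reach E x y
  connected = proj₁ (proj₂ (proj₂ tree))

  same-colour⇒same-edge : ∀ {e e′} → e ∈ₗ E → e′ ∈ₗ E → edgeColour φ e ≡ edgeColour φ e′ → e ≡ e′
  same-colour⇒same-edge = Walks.unique-map⇒injective (edgeColour φ) rainbow

module LowerBound {n r : ℕ} (φ : Fin n → Fin n → Fin r) (c : Fin r) (W : Fin n → Set)
                  (W-colour : ∀ {x y} → x ≢ y → W x ⊎ W y → φ x y ≡ c) where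
  open Counting
  open Sums
  open Walks using (reach-closed; first-edge)

  module _ {k} {p : Fin n → Fin k} {i : Fin k} {E : List (Fin n × Fin n)}
           (tree : IsHeteroSpanningTree φ p i E) where
    open Tree tree

    Touches : Fin n × Fin n → Fin n → Set
    Touches e w = proj₁ e ≡ w ⊎ proj₂ e ≡ w

    c-edge-at : ∀ {w y} → W w → p w ≡ i → p y ≡ i → w ≢ y →
      ∃ λ e → e ∈ₗ E × edgeColour φ e ≡ c × Touches e w
    c-edge-at {w} {y} ww pw py w≢y with first-edge (connected w y pw py) w≢y
    ... | z , inj₁ e∈ = (w , z) , e∈ , W-colour (proj₁ (edges-inside e∈)) (inj₁ ww) , inj₁ refl
    ... | z , inj₂ e∈ = (z , w) , e∈ , W-colour (proj₁ (edges-inside e∈)) (inj₂ ww) , inj₂ refl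

    touches-both : ∀ {w₁ w₂} → w₁ ≢ w₂ → (e : Fin n × Fin n) → Touches e w₁ → Touches e w₂ →
      (proj₁ e ≡ w₁ ⊎ proj₁ e ≡ w₂) × (proj₂ e ≡ w₁ ⊎ proj₂ e ≡ w₂)
    touches-both w₁≢w₂ _ (inj₁ refl) (inj₁ refl) = ⊥-elim (w₁≢w₂ refl)
    touches-both w₁≢w₂ _ (inj₁ refl) (inj₂ refl) = inj₁ refl , inj₂ refl
    touches-both w₁≢w₂ _ (inj₂ refl) (inj₁ refl) = inj₂ refl , inj₁ refl
    touches-both w₁≢w₂ _ (inj₂ refl) (inj₂ refl) = ⊥-elim (w₁≢w₂ refl)

    -- a tree containing two vertices w₁ ≠ w₂ of W is the single edge w₁ w₂:
    -- both have a c-coloured edge, which must be one and the same edge e, and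
    -- every other edge at w₁ or w₂ would also be coloured c, so {w₁, w₂} is
    -- closed under walks in the tree
    two-W-vertices : ∀ {w₁ w₂ y} → W w₁ → W w₂ → w₁ ≢ w₂ →
      p w₁ ≡ i → p w₂ ≡ i → p y ≡ i → y ≡ w₁ ⊎ y ≡ w₂
    two-W-vertices {w₁} {w₂} {y} ww₁ ww₂ w₁≢w₂ pw₁ pw₂ py
      with c-edge-at ww₁ pw₁ pw₂ w₁≢w₂ | c-edge-at ww₂ pw₂ pw₁ (≢-sym w₁≢w₂)
    ... | e , e∈ , e-c , e-at-w₁ | e′ , e′∈ , e′-c , e′-at-w₂ =
      reach-closed Pair closed (connected w₁ y pw₁ py) (inj₁ refl)
      where
      Pair : Fin n → Set
      Pair x = x ≡ w₁ ⊎ x ≡ w₂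
      Pair⇒W : ∀ {x} → Pair x → W x
      Pair⇒W (inj₁ refl) = ww₁
      Pair⇒W (inj₂ refl) = ww₂
      e≡e′ : e ≡ e′
      e≡e′ = same-colour⇒same-edge e∈ e′∈ (trans e-c (sym e′-c))
      e-ends : Pair (proj₁ e) × Pair (proj₂ e)
      e-ends = touches-both w₁≢w₂ e e-at-w₁ (subst (λ f → Touches f w₂) (sym e≡e′) e′-at-w₂)
      closed : ∀ {a b} → (a , b) ∈ₗ E → Pair a ⊎ Pair b → Pair a × Pair b
      closed f∈ touch =
        subst (λ f → Pair (proj₁ f) × Pair (proj₂ f))
              (same-colour⇒same-edge e∈ f∈
                 (trans e-c (sym (W-colour (proj₁ (edges-inside f∈)) (⊎-map Pair⇒W Pair⇒W touch)))))
              e-ends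

  module _ (S : Subset n) (u : Fin n) (outside⇒W : ∀ {x} → x ∉ S → x ≢ u → W x) where

    Outside? : (x : Fin n) → Dec (x ∉ S)
    Outside? x = ¬? (x ∈? S)

    -- every tree contains at most two vertices outside S: of any three, two
    -- differ from u and hence lie in W
    outside-per-tree : ∀ {k} {p : Fin n → Fin k} {i : Fin k} {E : List (Fin n × Fin n)} →
      IsHeteroSpanningTree φ p i E → count (λ x → Outside? x ×-dec (p x ≟ i)) ≤ 2
    outside-per-tree {p = p} {i} tree = count-≤2 (λ x → Outside? x ×-dec (p x ≟ i)) noTriple
      where
      excluded : ∀ {w₁ w₂ y} → w₁ ∉ S × p w₁ ≡ i → w₂ ∉ S × p w₂ ≡ i → p y ≡ i →
        w₁ ≢ u → w₂ ≢ u → w₁ ≢ w₂ → w₁ ≢ y → w₂ ≢ y → ⊥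
      excluded (w₁∉ , pw₁) (w₂∉ , pw₂) py w₁≢u w₂≢u w₁≢w₂ w₁≢y w₂≢y
        with two-W-vertices tree (outside⇒W w₁∉ w₁≢u) (outside⇒W w₂∉ w₂≢u) w₁≢w₂ pw₁ pw₂ py
      ... | inj₁ y≡w₁ = w₁≢y (sym y≡w₁)
      ... | inj₂ y≡w₂ = w₂≢y (sym y≡w₂)
      noTriple : ∀ {x y z} → x ∉ S × p x ≡ i → y ∉ S × p y ≡ i → z ∉ S × p z ≡ i →
        x ≢ y → x ≢ z → y ≢ z → ⊥
      noTriple {x} {y} {z} ox oy oz x≢y x≢z y≢z with x ≟ u | y ≟ u
      ... | yes refl | _ = excluded oy oz (proj₂ ox) (≢-sym x≢y) (≢-sym x≢z)
                             y≢z (≢-sym x≢y) (≢-sym x≢z)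
      ... | no x≢u | yes refl = excluded ox oz (proj₂ oy) x≢u (≢-sym y≢z) x≢z x≢y (≢-sym y≢z)
      ... | no x≢u | no y≢u = excluded ox oy (proj₂ oz) x≢u y≢u x≢y x≢z y≢z

    lower-bound : ∀ k → HeteroTreeCover n r φ k → ⌈ (n ∸ ∣ S ∣) /2⌉ ≤ k
    lower-bound k (p , trees , _ , isTree) = begin
      ⌈ (n ∸ ∣ S ∣) /2⌉ ≤⟨ ⌈n/2⌉-mono outside≤k+k ⟩
      ⌈ (k + k) /2⌉     ≡⟨ sym (n≡⌈n+n/2⌉ k) ⟩
      k                 ∎
      where
      open ≤-Reasoning
      outside≤k+k : n ∸ ∣ S ∣ ≤ k + k
      outside≤k+k = begin
        n ∸ ∣ S ∣                                                  ≡⟨ sym (count-∉ S) ⟩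
        count Outside?                                             ≡⟨ count-partition Outside? p ⟩
        sumFin k (λ i → count (λ x → Outside? x ×-dec (p x ≟ i))) ≤⟨ sum-≤ k _ 2 (λ i → outside-per-tree (isTree i)) ⟩
        k * 2                                                      ≡⟨ *-comm k 2 ⟩
        k + (k + 0)                                                ≡⟨ cong (k +_) (+-identityʳ k) ⟩
        k + k                                                      ∎

module Pairing where
  open import Data.List.Relation.Unary.All.Properties using (¬Any⇒All¬; All¬⇒¬Any)
  import Data.List.Relation.Unary.All as All

  module _ {A : Set} where

    pairUp : List A → List (A × A)
    pairUp (a ∷ b ∷ l) = (a , b) ∷ pairUp l
    pairUp _           = []

    leftover : List A → Maybe A
    leftover []          = nothing
    leftover (a ∷ [])    = just a
    leftover (a ∷ b ∷ l) = leftover l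

    ends : List (A × A) → List A
    ends []             = []
    ends ((a , b) ∷ L) = a ∷ b ∷ ends L

    ∈⇒paired⊎leftover : ∀ {x} l → x ∈ₗ l → x ∈ₗ ends (pairUp l) ⊎ leftover l ≡ just x
    ∈⇒paired⊎leftover (a ∷ [])    (here refl)         = inj₂ refl
    ∈⇒paired⊎leftover (a ∷ b ∷ l) (here refl)         = inj₁ (here refl)
    ∈⇒paired⊎leftover (a ∷ b ∷ l) (there (here refl)) = inj₁ (there (here refl))
    ∈⇒paired⊎leftover (a ∷ b ∷ l) (there (there x∈)) with ∈⇒paired⊎leftover l x∈
    ... | inj₁ paired = inj₁ (there (there paired))
    ... | inj₂ left   = inj₂ left

    paired⇒∈ : ∀ {x} l → x ∈ₗ ends (pairUp l) → x ∈ₗ l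
    paired⇒∈ (a ∷ b ∷ l) (here refl)         = here refl
    paired⇒∈ (a ∷ b ∷ l) (there (here refl)) = there (here refl)
    paired⇒∈ (a ∷ b ∷ l) (there (there x∈))  = there (there (paired⇒∈ l x∈))

    leftover⇒∈ : ∀ {x} l → leftover l ≡ just x → x ∈ₗ l
    leftover⇒∈ (a ∷ [])    refl = here refl
    leftover⇒∈ (a ∷ b ∷ l) left = there (there (leftover⇒∈ l left))

    pairUp-unique : ∀ l → Unique l → Unique (ends (pairUp l))
    pairUp-unique []          _ = []
    pairUp-unique (a ∷ [])    _ = []
    pairUp-unique (a ∷ b ∷ l) (a∉ ∷ b∉ ∷ u) =
      ¬Any⇒All¬ _ (λ { (here a≡b) → All.lookup a∉ (here refl) a≡b
                     ; (there a∈) → All¬⇒¬Any a∉ (there (paired⇒∈ l a∈)) })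
      ∷ ¬Any⇒All¬ _ (λ b∈ → All¬⇒¬Any b∉ (paired⇒∈ l b∈))
      ∷ pairUp-unique l u

    leftover-unpaired : ∀ {x} l → Unique l → leftover l ≡ just x → x ∉ₗ ends (pairUp l)
    leftover-unpaired (a ∷ [])    _ _ ()
    leftover-unpaired (a ∷ b ∷ l) (a∉ ∷ b∉ ∷ u) left (here refl) = All¬⇒¬Any a∉ (there (leftover⇒∈ l left))
    leftover-unpaired (a ∷ b ∷ l) (a∉ ∷ b∉ ∷ u) left (there (here refl)) = All¬⇒¬Any b∉ (leftover⇒∈ l left)
    leftover-unpaired (a ∷ b ∷ l) (a∉ ∷ b∉ ∷ u) left (there (there x∈)) = leftover-unpaired l u left x∈

    pairUp-parts : ∀ l → suc (length (pairUp l)) ≡ ⌈ suc (length l) /2⌉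
    pairUp-parts []          = refl
    pairUp-parts (a ∷ [])    = refl
    pairUp-parts (a ∷ b ∷ l) = cong suc (pairUp-parts l)

  -- Part suc j consists of the two ends of the j-th pair of L, part zero of
  -- all vertices that are not an end of a pair.
  module _ {n : ℕ} where

    Ends : (L : List (Fin n × Fin n)) → Fin (length L) → Fin n → Set
    Ends L j x = x ≡ proj₁ (lookup L j) ⊎ x ≡ proj₂ (lookup L j)

    -- the parts of the later pairs move one index up
    later : ∀ {m} → Fin (suc m) → Fin (suc (suc m))
    later zero    = zero
    later (suc j) = suc (suc j)

    later-zero : ∀ {m} {j : Fin (suc m)} → later j ≡ zero → j ≡ zero
    later-zero {j = zero} _ = refl

    later-suc : ∀ {m} {j : Fin (suc m)} {k} → later j ≡ suc (suc k) → j ≡ suc k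
    later-suc {j = suc _} refl = refl

    later≢one : ∀ {m} {j : Fin (suc m)} → later j ≢ suc zero
    later≢one {j = zero}  ()
    later≢one {j = suc _} ()

    pairPart : (L : List (Fin n × Fin n)) → Fin n → Fin (suc (length L))
    pairPart []            x = zero
    pairPart ((a , b) ∷ L) x with (x ≟ a) ⊎-dec (x ≟ b)
    ... | yes _ = suc zero
    ... | no _  = later (pairPart L x)

    pairPart-zero⇒unpaired : ∀ L x → pairPart L x ≡ zero → x ∉ₗ ends L
    pairPart-zero⇒unpaired ((a , b) ∷ L) x part≡0 x∈ with (x ≟ a) ⊎-dec (x ≟ b)
    pairPart-zero⇒unpaired ((a , b) ∷ L) x () x∈                  | yes _
    pairPart-zero⇒unpaired ((a , b) ∷ L) x _  (here refl)         | no x∉ab = x∉ab (inj₁ refl)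
    pairPart-zero⇒unpaired ((a , b) ∷ L) x _  (there (here refl)) | no x∉ab = x∉ab (inj₂ refl)
    pairPart-zero⇒unpaired ((a , b) ∷ L) x part≡0 (there (there x∈)) | no _ =
      pairPart-zero⇒unpaired L x (later-zero part≡0) x∈

    unpaired⇒pairPart-zero : ∀ L x → x ∉ₗ ends L → pairPart L x ≡ zero
    unpaired⇒pairPart-zero []            x _ = refl
    unpaired⇒pairPart-zero ((a , b) ∷ L) x x∉ with (x ≟ a) ⊎-dec (x ≟ b)
    ... | yes (inj₁ refl) = ⊥-elim (x∉ (here refl))
    ... | yes (inj₂ refl) = ⊥-elim (x∉ (there (here refl)))
    ... | no _            = cong later (unpaired⇒pairPart-zero L x (λ x∈ → x∉ (there (there x∈))))

    pairPart-suc⇒end : ∀ L x j → pairPart L x ≡ suc j → Ends L j x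
    pairPart-suc⇒end ((a , b) ∷ L) x j part≡ with (x ≟ a) ⊎-dec (x ≟ b)
    pairPart-suc⇒end ((a , b) ∷ L) x zero    _     | yes x∈ab = x∈ab
    pairPart-suc⇒end ((a , b) ∷ L) x (suc j) ()    | yes _
    pairPart-suc⇒end ((a , b) ∷ L) x zero    part≡ | no _ = ⊥-elim (later≢one part≡)
    pairPart-suc⇒end ((a , b) ∷ L) x (suc j) part≡ | no _ = pairPart-suc⇒end L x j (later-suc part≡)

    end∈ends : ∀ (L : List (Fin n × Fin n)) j {x} → Ends L j x → x ∈ₗ ends L
    end∈ends ((a , b) ∷ L) zero    (inj₁ refl) = here refl
    end∈ends ((a , b) ∷ L) zero    (inj₂ refl) = there (here refl)
    end∈ends ((a , b) ∷ L) (suc j) x∈          = there (there (end∈ends L j x∈))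

    end⇒pairPart-suc : ∀ L x j → Unique (ends L) → Ends L j x → pairPart L x ≡ suc j
    end⇒pairPart-suc ((a , b) ∷ L) x j u x∈ with (x ≟ a) ⊎-dec (x ≟ b)
    end⇒pairPart-suc ((a , b) ∷ L) x zero    _ _  | yes _    = refl
    end⇒pairPart-suc ((a , b) ∷ L) x zero    _ x∈ | no x∉ab  = ⊥-elim (x∉ab x∈)
    end⇒pairPart-suc ((a , b) ∷ L) x (suc j) (a∉ ∷ _ ∷ _) x∈ | yes (inj₁ refl) =
      ⊥-elim (All¬⇒¬Any a∉ (there (end∈ends L j x∈)))
    end⇒pairPart-suc ((a , b) ∷ L) x (suc j) (_ ∷ b∉ ∷ _) x∈ | yes (inj₂ refl) =
      ⊥-elim (All¬⇒¬Any b∉ (end∈ends L j x∈))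
    end⇒pairPart-suc ((a , b) ∷ L) x (suc j) (_ ∷ _ ∷ u) x∈ | no _ = cong later (end⇒pairPart-suc L x j u x∈)

    lookup-distinct : ∀ (L : List (Fin n × Fin n)) j → Unique (ends L) →
      proj₁ (lookup L j) ≢ proj₂ (lookup L j)
    lookup-distinct ((a , b) ∷ L) zero    (a∉ ∷ _)     = All.lookup a∉ (here refl)
    lookup-distinct ((a , b) ∷ L) (suc j) (_ ∷ _ ∷ u) = lookup-distinct L j u

module RainbowTrees {n r : ℕ} (φ : Fin n → Fin n → Fin r) where
  open Counting
  open Walks using (reach-trans; reach-sym; reach-weaken)

  record RainbowTree {V : Fin n → Set} (V? : Decidable V) (E : List (Fin n × Fin n)) : Set where
    field
      edges-inside : ∀ {x y} → (x , y) ∈ₗ E → x ≢ y × V x × V y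
      rainbow      : Unique (map (edgeColour φ) E)
      connected    : ∀ {x y} → V x → V y → Reach E x y
      size         : length E + 1 ≡ count V?

  single-vertex : (v : Fin n) → RainbowTree (λ x → x ≟ v) []
  single-vertex v = record
    { edges-inside = λ ()
    ; rainbow      = []
    ; connected    = λ { refl refl → here }
    ; size         = sym (count-singleton v)
    }

  add-leaf : ∀ {V : Fin n → Set} {V? : Decidable V} {E} → RainbowTree V? E →
    ∀ {w v} → ¬ V w → V v → All (edgeColour φ (w , v) ≢_) (map (edgeColour φ) E) →
    RainbowTree (λ x → V? x ⊎-dec (x ≟ w)) ((w , v) ∷ E)
  add-leaf {V} {V?} {E} tree {w} {v} w∉V v∈V new-colour = record
    { edges-inside = λ { (here refl) → w≢v , inj₂ refl , inj₁ v∈V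
                       ; (there e∈) → let (x≢y , vx , vy) = edges-inside e∈ in x≢y , inj₁ vx , inj₁ vy }
    ; rainbow      = new-colour ∷ rainbow
    ; connected    = λ x∈ y∈ → reach-trans (to-v x∈) (reach-sym (to-v y∈))
    ; size         = trans (cong suc size) (sym (count-insert V? w w∉V))
    }
    where
    open RainbowTree tree
    w≢v : w ≢ v
    w≢v refl = w∉V v∈V
    to-v : ∀ {x} → V x ⊎ x ≡ w → Reach ((w , v) ∷ E) x v
    to-v (inj₁ x∈V)  = reach-weaken there (connected x∈V v∈V)
    to-v (inj₂ refl) = fwd (here refl) here

  single-edge : ∀ {a b} → a ≢ b → RainbowTree (λ x → (x ≟ b) ⊎-dec (x ≟ a)) ((a , b) ∷ [])
  single-edge a≢b = add-leaf (single-vertex _) a≢b refl []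

  part-tree : ∀ {k} {p : Fin n → Fin k} {i : Fin k} {V : Fin n → Set} {V? : Decidable V} {E} →
    (∀ x → p x ≡ i → V x) → (∀ x → V x → p x ≡ i) → RainbowTree V? E → IsHeteroSpanningTree φ p i E
  part-tree {p = p} {i} {V? = V?} part⇒V V⇒part tree =
      (λ e∈ → let (x≢y , vx , vy) = edges-inside e∈ in x≢y , V⇒part _ vx , V⇒part _ vy)
    , rainbow
    , (λ x y px py → connected (part⇒V x px) (part⇒V y py))
    , trans size (sym (trans (length-filter-allFin (λ x → p x ≟ i)) (count-cong _ V? part⇒V V⇒part)))
    where open RainbowTree tree

other-colour : ∀ {r} → 2 ≤ r → (c : Fin r) → ∃ λ c′ → c′ ≢ c
other-colour (s≤s (s≤s _)) zero    = suc zero , λ ()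
other-colour (s≤s (s≤s _)) (suc _) = zero , λ ()

not-monochromatic : ∀ {n r} {φ : Fin n → Fin n → Fin r} → 2 ≤ r → IsREdgeColoring n r φ →
  (c : Fin r) → ¬ (∀ x y → x ≢ y → φ x y ≡ c)
not-monochromatic r≥2 (_ , surjective) c all-c with other-colour r≥2 c
... | c′ , c′≢c with surjective c′
...   | x , y , x≢y , φxy≡c′ = c′≢c (trans (sym φxy≡c′) (all-c x y x≢y))

module PhiStarColouring {n r : ℕ} (S : Subset n) (u : Fin n) (u∉S : u ∉ S)
         (φ : Fin n → Fin n → Fin r) (T : Subset n) (c : Fin r) (T⊆S : T ⊆ S)
         (A-distinct : ∀ (x y x′ y′ : Fin n) → x ≢ y → x′ ≢ y′ →
            InA S u T x y → InA S u T x′ y′ → φ x y ≡ φ x′ y′ → SameEdge x y x′ y′)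
         (common : ∀ (x y : Fin n) → x ≢ y → ¬ InA S u T x y → φ x y ≡ c) where
  open Counting
  open RainbowTrees φ
  open Walks using (injective⇒unique-map; reach-trans; reach-sym)
  open import Data.List.Membership.Propositional.Properties using (∈-map⁻; ∈-map⁺; ∈-filter⁻; ∈-filter⁺; ∈-allFin)
  open import Data.List.Relation.Unary.Unique.Propositional.Properties using (filter⁺; allFin⁺)
  open import Data.List.Relation.Unary.All.Properties using () renaming (map⁺ to All-map⁺)
  import Data.List.Relation.Unary.All as All
  open import Data.List.Properties using (length-map)

  Outer : Fin n → Set
  Outer x = x ∉ S × x ≢ u

  Outer? : (x : Fin n) → Dec (Outer x)
  Outer? x = ¬? (x ∈? S) ×-dec ¬? (x ≟ u)

  outer-not-A : ∀ {x y} → Outer x ⊎ Outer y → ¬ InA S u T x y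
  outer-not-A (inj₁ (x∉S , _))   (inj₁ (x∈S , _))         = x∉S x∈S
  outer-not-A (inj₁ (_ , x≢u))   (inj₂ (inj₁ (x≡u , _))) = x≢u x≡u
  outer-not-A (inj₁ (x∉S , _))   (inj₂ (inj₂ (_ , x∈T))) = x∉S (T⊆S x∈T)
  outer-not-A (inj₂ (y∉S , _))   (inj₁ (_ , y∈S))         = y∉S y∈S
  outer-not-A (inj₂ (y∉S , _))   (inj₂ (inj₁ (_ , y∈T))) = y∉S (T⊆S y∈T)
  outer-not-A (inj₂ (_ , y≢u))   (inj₂ (inj₂ (y≡u , _))) = y≢u y≡u

  outer-colour : ∀ {x y} → x ≢ y → Outer x ⊎ Outer y → φ x y ≡ c
  outer-colour {x} {y} x≢y outer = common x y x≢y (outer-not-A outer)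

  lower-bound : ∀ k → HeteroTreeCover n r φ k → ⌈ (n ∸ ∣ S ∣) /2⌉ ≤ k
  lower-bound = LowerBound.lower-bound φ c Outer outer-colour S u _,_

  Core : Fin n → Set
  Core x = x ∈ S ⊎ x ≡ u

  Core? : (x : Fin n) → Dec (Core x)
  Core? x = (x ∈? S) ⊎-dec (x ≟ u)

  core-not-outer : ∀ {x} → Core x → ¬ Outer x
  core-not-outer (inj₁ x∈S) (x∉S , _) = x∉S x∈S
  core-not-outer (inj₂ x≡u) (_ , x≢u) = x≢u x≡u

  NonRoot : Fin n → Fin n → Set
  NonRoot v y = Core y × y ≢ v

  NonRoot? : (v x : Fin n) → Dec (NonRoot v x)
  NonRoot? v x = Core? x ×-dec ¬? (x ≟ v)

  record ParentMap : Set where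
    field
      root             : Fin n
      root∈S           : root ∈ S
      parent           : Fin n → Fin n
      parent-edge      : ∀ {y} → NonRoot root y → Core (parent y) × parent y ≢ y × InA S u T (parent y) y
      parent-injective : ∀ {y y′} → NonRoot root y → NonRoot root y′ →
                         SameEdge (parent y) y (parent y′) y′ → y ≡ y′
      parent-colour    : ∀ {y} → NonRoot root y → φ (parent y) y ≢ c
      depth≤2          : ∀ {y} → NonRoot root y →
                         parent y ≡ root ⊎ (NonRoot root (parent y) × parent (parent y) ≡ root)

  module CoreTree (pm : ParentMap) where
    open ParentMap pm

    nonRoots : List (Fin n)
    nonRoots = filter (NonRoot? root) (allFin n)

    nonRoot∈ : ∀ {y} → NonRoot root y → y ∈ₗ nonRoots
    nonRoot∈ ny = ∈-filter⁺ (NonRoot? root) (∈-allFin _) ny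

    toParent : Fin n → Fin n × Fin n
    toParent y = parent y , y

    coreEdges : List (Fin n × Fin n)
    coreEdges = map toParent nonRoots

    coreEdge⇒ : ∀ {e} → e ∈ₗ coreEdges → ∃ λ y → NonRoot root y × e ≡ toParent y
    coreEdge⇒ e∈ with ∈-map⁻ toParent e∈
    ... | y , y∈ , refl = y , proj₂ (∈-filter⁻ (NonRoot? root) {xs = allFin n} y∈) , refl

    coreEdges-colour≢c : All (c ≢_) (map (edgeColour φ) coreEdges)
    coreEdges-colour≢c = All-map⁺ (All.tabulate λ e∈ c≡ → not-c e∈ (sym c≡))
      where
      not-c : ∀ {e} → e ∈ₗ coreEdges → edgeColour φ e ≢ c
      not-c e∈ with coreEdge⇒ e∈
      ... | y , ny , refl = parent-colour ny

    -- distinct non-root vertices give A-edges of distinct colours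
    coreEdges-rainbow : Unique (map (edgeColour φ) coreEdges)
    coreEdges-rainbow =
      injective⇒unique-map (edgeColour φ) coreEdges colour-injective
        (injective⇒unique-map toParent nonRoots (λ _ _ → cong proj₂) (filter⁺ (NonRoot? root) (allFin⁺ n)))
      where
      colour-injective : ∀ {a b} → a ∈ₗ coreEdges → b ∈ₗ coreEdges → edgeColour φ a ≡ edgeColour φ b → a ≡ b
      colour-injective a∈ b∈ same with coreEdge⇒ a∈ | coreEdge⇒ b∈
      ... | y , ny , refl | y′ , ny′ , refl =
        let (_ , py≢y , A) = parent-edge ny ; (_ , py′≢y′ , A′) = parent-edge ny′
        in cong toParent (parent-injective ny ny′ (A-distinct _ _ _ _ py≢y py′≢y′ A A′ same))

    up : ∀ {y} → NonRoot root y → Reach coreEdges (parent y) root → Reach coreEdges y root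
    up ny = bwd (∈-map⁺ toParent (nonRoot∈ ny))

    at-root : ∀ {x} → x ≡ root → Reach coreEdges x root
    at-root refl = here

    to-root : ∀ {x} → Core x → Reach coreEdges x root
    to-root {x} cx with x ≟ root
    ... | yes refl = here
    ... | no x≢root with depth≤2 (cx , x≢root)
    ...   | inj₁ px≡root          = up (cx , x≢root) (at-root px≡root)
    ...   | inj₂ (npx , ppx≡root) = up (cx , x≢root) (up npx (at-root ppx≡root))

    coreTree : RainbowTree Core? coreEdges
    coreTree = record
      { edges-inside = λ e∈ → ends (coreEdge⇒ e∈)
      ; rainbow      = coreEdges-rainbow
      ; connected    = λ cx cy → reach-trans (to-root cx) (reach-sym (to-root cy))
      ; size         = begin
          length coreEdges + 1           ≡⟨ cong (_+ 1) (length-map toParent nonRoots) ⟩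
          length nonRoots + 1            ≡⟨ cong (_+ 1) (length-filter-allFin (NonRoot? root)) ⟩
          count (NonRoot? root) + 1      ≡⟨ +-comm _ 1 ⟩
          suc (count (NonRoot? root))    ≡⟨ sym (count-remove Core? root (inj₁ root∈S)) ⟩
          count Core?                    ∎
      }
      where
      open ≡-Reasoning
      ends : ∀ {a b} → (∃ λ y → NonRoot root y × (a , b) ≡ toParent y) → a ≢ b × Core a × Core b
      ends (y , ny , refl) = let (cpy , py≢y , _) = parent-edge ny in py≢y , cpy , proj₁ ny

  module Cover (pm : ParentMap) where
    open ParentMap pm
    open CoreTree pm
    open Pairing

    outers : List (Fin n)
    outers = filter Outer? (allFin n)

    outer∈ : ∀ {x} → Outer x → x ∈ₗ outers
    outer∈ ox = ∈-filter⁺ Outer? (∈-allFin _) ox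

    ∈outer : ∀ {x} → x ∈ₗ outers → Outer x
    ∈outer x∈ = proj₂ (∈-filter⁻ Outer? {xs = allFin n} x∈)

    outers-unique : Unique outers
    outers-unique = filter⁺ Outer? (allFin⁺ n)

    pairs : List (Fin n × Fin n)
    pairs = pairUp outers

    pairs-unique : Unique (ends pairs)
    pairs-unique = pairUp-unique outers outers-unique

    part : Fin n → Fin (suc (length pairs))
    part = pairPart pairs

    BigPart : Fin n → Set
    BigPart x = Core x ⊎ leftover outers ≡ just x

    part-zero⇒big : ∀ x → part x ≡ zero → BigPart x
    part-zero⇒big x part≡0 with Core? x
    ... | yes cx = inj₁ cx
    ... | no ¬cx with ∈⇒paired⊎leftover outers (outer∈ (¬cx ∘ inj₁ , ¬cx ∘ inj₂))
    ...   | inj₁ paired = ⊥-elim (pairPart-zero⇒unpaired pairs x part≡0 paired)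
    ...   | inj₂ left   = inj₂ left

    big⇒part-zero : ∀ x → BigPart x → part x ≡ zero
    big⇒part-zero x (inj₁ cx)   = unpaired⇒pairPart-zero pairs x
                                    (λ paired → core-not-outer cx (∈outer (paired⇒∈ outers paired)))
    big⇒part-zero x (inj₂ left) = unpaired⇒pairPart-zero pairs x (leftover-unpaired outers outers-unique left)

    bigTree : ∃ λ E → IsHeteroSpanningTree φ part zero E
    bigTree with leftover outers in eq
    ... | nothing = coreEdges , part-tree onlyCore (λ x cx → big⇒part-zero x (inj₁ cx)) coreTree
      where
      onlyCore : ∀ x → part x ≡ zero → Core x
      onlyCore x part≡0 with part-zero⇒big x part≡0
      ... | inj₁ cx = cx
      ... | inj₂ left with () ← trans (sym eq) left
    ... | just w = (w , root) ∷ coreEdges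
                 , part-tree coreOrW (λ x → big⇒part-zero x ∘ fromCoreOrW)
                     (add-leaf coreTree (λ cw → core-not-outer cw outer-w) (inj₁ root∈S) new-colour)
      where
      outer-w : Outer w
      outer-w = ∈outer (leftover⇒∈ outers eq)
      w≢root : w ≢ root
      w≢root refl = proj₁ outer-w root∈S
      new-colour : All (edgeColour φ (w , root) ≢_) (map (edgeColour φ) coreEdges)
      new-colour = subst (λ d → All (d ≢_) (map (edgeColour φ) coreEdges))
                         (sym (outer-colour w≢root (inj₁ outer-w))) coreEdges-colour≢c
      coreOrW : ∀ x → part x ≡ zero → Core x ⊎ x ≡ w
      coreOrW x part≡0 with part-zero⇒big x part≡0
      ... | inj₁ cx = inj₁ cx
      ... | inj₂ left with trans (sym eq) left
      ...   | refl = inj₂ refl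
      fromCoreOrW : ∀ {x} → Core x ⊎ x ≡ w → BigPart x
      fromCoreOrW (inj₁ cx)   = inj₁ cx
      fromCoreOrW (inj₂ refl) = inj₂ eq

    pairTree : (j : Fin (length pairs)) →
      IsHeteroSpanningTree φ part (suc j) ((proj₁ (lookup pairs j) , proj₂ (lookup pairs j)) ∷ [])
    pairTree j = part-tree (λ x → swap ∘ pairPart-suc⇒end pairs x j)
                           (λ x → end⇒pairPart-suc pairs x j pairs-unique ∘ swap)
                           (single-edge (lookup-distinct pairs j pairs-unique))

    number-of-parts : suc (length pairs) ≡ ⌈ (n ∸ ∣ S ∣) /2⌉
    number-of-parts = trans (pairUp-parts outers) (cong ⌈_/2⌉ (begin
      suc (length outers)          ≡⟨ cong suc (length-filter-allFin Outer?) ⟩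
      suc (count Outer?)           ≡⟨ sym (count-remove (λ x → ¬? (x ∈? S)) u u∉S) ⟩
      count (λ x → ¬? (x ∈? S))    ≡⟨ count-∉ S ⟩
      n ∸ ∣ S ∣                    ∎))
      where open ≡-Reasoning

    cover : HeteroTreeCover n r φ ⌈ (n ∸ ∣ S ∣) /2⌉
    cover = subst (HeteroTreeCover n r φ) number-of-parts (part , trees , nonempty , isTree)
      where
      trees : Fin (suc (length pairs)) → List (Fin n × Fin n)
      trees zero    = proj₁ bigTree
      trees (suc j) = (proj₁ (lookup pairs j) , proj₂ (lookup pairs j)) ∷ []
      nonempty : ∀ i → ∃ λ x → part x ≡ i
      nonempty zero    = root , big⇒part-zero root (inj₁ (inj₁ root∈S))
      nonempty (suc j) = proj₁ (lookup pairs j) , end⇒pairPart-suc pairs _ j pairs-unique (inj₁ refl)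
      isTree : ∀ i → IsHeteroSpanningTree φ part i (trees i)
      isTree zero    = proj₂ bigTree
      isTree (suc j) = pairTree j

  -- Parent maps towards a root v₁ ∈ T: every core vertex y ≠ v₁ is joined
  -- to v₁ by an A-edge, at most one of which is coloured c.
  module ParentMaps {v₁ : Fin n} (v₁∈T : v₁ ∈ T) where

    v₁∈S : v₁ ∈ S
    v₁∈S = T⊆S v₁∈T

    star-edge : ∀ {y} → NonRoot v₁ y → Core v₁ × v₁ ≢ y × InA S u T v₁ y
    star-edge (inj₁ y∈S , y≢v₁) = inj₁ v₁∈S , ≢-sym y≢v₁ , inj₁ (v₁∈S , y∈S)
    star-edge (inj₂ y≡u , y≢v₁) = inj₁ v₁∈S , ≢-sym y≢v₁ , inj₂ (inj₂ (y≡u , v₁∈T))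

    star-edge-injective : ∀ {y y′} → NonRoot v₁ y′ → SameEdge v₁ y v₁ y′ → y ≡ y′
    star-edge-injective _   (inj₁ (_ , y≡y′))  = y≡y′
    star-edge-injective ny′ (inj₂ (v₁≡y′ , _)) = ⊥-elim (proj₂ ny′ (sym v₁≡y′))

    star-colour-injective : ∀ {y y′} → NonRoot v₁ y → NonRoot v₁ y′ → φ v₁ y ≡ φ v₁ y′ → y ≡ y′
    star-colour-injective ny ny′ same =
      let (_ , v₁≢y , A) = star-edge ny ; (_ , v₁≢y′ , A′) = star-edge ny′
      in star-edge-injective ny′ (A-distinct _ _ _ _ v₁≢y v₁≢y′ A A′ same)

    star : (∀ {y} → NonRoot v₁ y → φ v₁ y ≢ c) → ParentMap
    star no-c = record
      { root             = v₁
      ; root∈S           = v₁∈S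
      ; parent           = λ _ → v₁
      ; parent-edge      = star-edge
      ; parent-injective = λ _ → star-edge-injective
      ; parent-colour    = no-c
      ; depth≤2          = λ _ → inj₁ refl
      }

    -- otherwise the one star edge v₁ b of colour c is replaced by an edge
    -- z b, where z is a second vertex v₂ of T, or u when b = v₂
    module Rerouted {b : Fin n} (nb : NonRoot v₁ b) (bad : φ v₁ b ≡ c)
                    {v₂ : Fin n} (v₂∈T : v₂ ∈ T) (v₂≢v₁ : v₂ ≢ v₁) where

      detour : Σ (Fin n) λ z → NonRoot v₁ z × z ≢ b × InA S u T z b
      detour with b ≟ v₂
      ... | yes refl = u , (inj₂ refl , λ { refl → u∉S v₁∈S }) , (λ { refl → u∉S (T⊆S v₂∈T) })
                         , inj₂ (inj₁ (refl , v₂∈T))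
      ... | no b≢v₂  = v₂ , (inj₁ (T⊆S v₂∈T) , v₂≢v₁) , (≢-sym b≢v₂) , v₂-edge (proj₁ nb)
        where
        v₂-edge : Core b → InA S u T v₂ b
        v₂-edge (inj₁ b∈S) = inj₁ (T⊆S v₂∈T , b∈S)
        v₂-edge (inj₂ b≡u) = inj₂ (inj₂ (b≡u , v₂∈T))

      z : Fin n
      z = proj₁ detour

      nz : NonRoot v₁ z
      nz = proj₁ (proj₂ detour)

      z≢b : z ≢ b
      z≢b = proj₁ (proj₂ (proj₂ detour))

      z-edge : InA S u T z b
      z-edge = proj₂ (proj₂ (proj₂ detour))

      z≢v₁ : z ≢ v₁
      z≢v₁ = proj₂ nz

      b≢v₁ : b ≢ v₁
      b≢v₁ = proj₂ nb

      parent : Fin n → Fin n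
      parent y with y ≟ b
      ... | yes _ = z
      ... | no _  = v₁

      parent-edge : ∀ {y} → NonRoot v₁ y → Core (parent y) × parent y ≢ y × InA S u T (parent y) y
      parent-edge {y} ny with y ≟ b
      ... | yes refl = proj₁ nz , z≢b , z-edge
      ... | no _     = star-edge ny

      parent-injective : ∀ {y y′} → NonRoot v₁ y → NonRoot v₁ y′ → SameEdge (parent y) y (parent y′) y′ → y ≡ y′
      parent-injective {y} {y′} ny ny′ same with y ≟ b | y′ ≟ b | same
      ... | yes refl | yes refl | _                  = refl
      ... | yes refl | no _     | inj₁ (z≡v₁ , _)   = ⊥-elim (z≢v₁ z≡v₁)
      ... | yes refl | no _     | inj₂ (_ , b≡v₁)   = ⊥-elim (b≢v₁ b≡v₁)
      ... | no _     | yes refl | inj₁ (v₁≡z , _)   = ⊥-elim (z≢v₁ (sym v₁≡z))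
      ... | no _     | yes refl | inj₂ (v₁≡b , _)   = ⊥-elim (b≢v₁ (sym v₁≡b))
      ... | no _     | no _     | star-same         = star-edge-injective ny′ star-same

      -- a second c-coloured A-edge would repeat the colour of v₁ b
      parent-colour : ∀ {y} → NonRoot v₁ y → φ (parent y) y ≢ c
      parent-colour {y} ny with y ≟ b
      ... | yes refl = λ zb≡c → distinct-ends
              (A-distinct z b v₁ b z≢b (≢-sym b≢v₁) z-edge (proj₂ (proj₂ (star-edge nb))) (trans zb≡c (sym bad)))
        where
        distinct-ends : ¬ SameEdge z b v₁ b
        distinct-ends (inj₁ (z≡v₁ , _)) = z≢v₁ z≡v₁
        distinct-ends (inj₂ (z≡b , _))  = z≢b z≡b
      ... | no y≢b = λ v₁y≡c → y≢b (star-colour-injective ny nb (trans v₁y≡c (sym bad)))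

      depth≤2 : ∀ {y} → NonRoot v₁ y → parent y ≡ v₁ ⊎ (NonRoot v₁ (parent y) × parent (parent y) ≡ v₁)
      depth≤2 {y} ny with y ≟ b
      ... | no _     = inj₁ refl
      ... | yes refl with z ≟ b
      ...   | yes z≡b = ⊥-elim (z≢b z≡b)
      ...   | no _    = inj₂ (nz , refl)

      rerouted : ParentMap
      rerouted = record
        { root             = v₁
        ; root∈S           = v₁∈S
        ; parent           = parent
        ; parent-edge      = parent-edge
        ; parent-injective = parent-injective
        ; parent-colour    = parent-colour
        ; depth≤2          = depth≤2
        }

    only-bad-edge : ∣ S ∣ ≤ 1 → ∀ {b} → NonRoot v₁ b → φ v₁ b ≡ c → φ v₁ u ≡ c
    only-bad-edge ∣S∣≤1 (inj₁ b∈S , b≢v₁) bad = ⊥-elim (b≢v₁ (subset-≤1-unique S ∣S∣≤1 b∈S v₁∈S))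
    only-bad-edge ∣S∣≤1 (inj₂ refl , _)   bad = bad

    -- if S = {v₁}, the only A-edge is v₁ u; so if it has colour c, every
    -- edge has colour c
    monochromatic : ∣ S ∣ ≤ 1 → SymColoring n r φ → φ v₁ u ≡ c → ∀ x y → x ≢ y → φ x y ≡ c
    monochromatic ∣S∣≤1 symmetric v₁u≡c x y x≢y with A? x y
      where
      A? : ∀ x y → Dec (InA S u T x y)
      A? x y = ((x ∈? S) ×-dec (y ∈? S)) ⊎-dec (((x ≟ u) ×-dec (y ∈? T)) ⊎-dec ((y ≟ u) ×-dec (x ∈? T)))
    ... | no ¬A                          = common x y x≢y ¬A
    ... | yes (inj₁ (x∈S , y∈S))         = ⊥-elim (x≢y (subset-≤1-unique S ∣S∣≤1 x∈S y∈S))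
    ... | yes (inj₂ (inj₁ (refl , y∈T))) = begin
      φ u y  ≡⟨ cong (φ u) (subset-≤1-unique S ∣S∣≤1 (T⊆S y∈T) v₁∈S) ⟩
      φ u v₁ ≡⟨ symmetric u v₁ (λ { refl → u∉S v₁∈S }) ⟩
      φ v₁ u ≡⟨ v₁u≡c ⟩
      c      ∎
      where open ≡-Reasoning
    ... | yes (inj₂ (inj₂ (refl , x∈T))) =
      trans (cong (λ v → φ v u) (subset-≤1-unique S ∣S∣≤1 (T⊆S x∈T) v₁∈S)) v₁u≡c

    parentMap : 2 ≤ r → IsREdgeColoring n r φ → (2 ≤ ∣ S ∣ → ∃ λ v₂ → v₂ ∈ T × v₂ ≢ v₁) → ParentMap
    parentMap r≥2 colouring second with any? (λ y → NonRoot? v₁ y ×-dec (φ v₁ y ≟ c))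
    ... | no none = star (λ ny bad → none (_ , ny , bad))
    ... | yes (b , nb , bad) with ∣ S ∣ ≤? 1
    ...   | yes ∣S∣≤1 = ⊥-elim (not-monochromatic r≥2 colouring c
                          (monochromatic ∣S∣≤1 (proj₁ colouring) (only-bad-edge ∣S∣≤1 nb bad)))
    ...   | no ∣S∣≰1 with second (≰⇒> ∣S∣≰1)
    ...     | v₂ , v₂∈T , v₂≢v₁ = Rerouted.rerouted nb bad v₂∈T v₂≢v₁

T-lower : ∀ {n r t m} (T : Subset n) → t C 2 + 2 ≤ r → ∣ T ∣ ≡ (r ∸ t C 2) ⊓ t →
  m ≤ 2 → m ≤ t → m ≤ ∣ T ∣
T-lower {t = t} T r-lower ∣T∣≡ m≤2 m≤t =
  subst (_ ≤_) (sym ∣T∣≡) (⊓-glb (≤-trans m≤2 (m+n≤o⇒m≤o∸n 2 (≤-trans (≤-reflexive (+-comm 2 (t C 2))) r-lower))) m≤t)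

proposition2 : (n r t : ℕ) → 3 ≤ n → 2 ≤ r → r ≤ n C 2
    → 1 ≤ t → t C 2 + 2 ≤ r → r ≤ (t + 1) C 2 + 1
    → (S : Subset n) → ∣ S ∣ ≡ t → (u : Fin n) → u ∉ S
    → (φ : Fin n → Fin n → Fin r) → IsREdgeColoring n r φ → IsPhiStar n r t S u φ
    → TreeCoverNumber≡ n r φ ⌈ (n ∸ t) /2⌉
proposition2 n r t _ r≥2 _ t≥1 r-lower _ S ∣S∣≡t u u∉S φ colouring (T , c , T⊆S , ∣T∣≡ , A-distinct , common) =
  subst (λ s → TreeCoverNumber≡ n r φ ⌈ (n ∸ s) /2⌉) ∣S∣≡t (Cover.cover parents , lower-bound)
  where
  open PhiStarColouring S u u∉S φ T c T⊆S A-distinct common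
  open Counting using (subset-witness; subset-another)
  root : ∃ (_∈ T)
  root = subset-witness T (T-lower T r-lower ∣T∣≡ (s≤s z≤n) t≥1)
  second : 2 ≤ ∣ S ∣ → ∃ λ v₂ → v₂ ∈ T × v₂ ≢ proj₁ root
  second two = subset-another T (proj₂ root) (T-lower T r-lower ∣T∣≡ ≤-refl (subst (2 ≤_) ∣S∣≡t two))
  parents : ParentMap
  parents = ParentMaps.parentMap (proj₂ root) r≥2 colouring second
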